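{- Let $\xi(s_1,\dots,s_\ell)=a_1s_1+\dots+a_\ell s_\ell$ and $\xi'(s_1,\dots,s_\ell)=a_1's_1+\dots+a_\ell's_\ell$ with $a_1,\dots,a_\ell,a_1',\dots,a_\ell'\in\mathbb{Z}\setminus\{0\}$, and let $Q$ be a positive integer such that for each $i$, $a_i'$ divides $a_i$ and $a_i/a_i'$ divides $Q$. Let $S\geq2$ be an integer and $\varepsilon>0$. If $(f,\widetilde f)$ is an $\varepsilon$-discrepancy pair with width $S$ with respect to $\xi$, then $(f,\widetilde f)$ is an $\varepsilon$-discrepancy pair with width $QS$ with respect to $\xi'$.
   Context: $G=\mathbb{Z}/N\mathbb{Z}$ with $N$ prime; $[S]=\{1,\dots,S\}$. For functions $f,\widetilde f:G\to\mathbb{R}$ and a linear form $\xi$ in $\ell$ variables, $(f,\widetilde f)$ is an $\varepsilon$-discrepancy pair with width $S$ with respect to $\xi$ if for all functions $u_1,\dots,u_\ell:G^{\ell+1}\to[-1,1]$ such that $u_i(n,s_1,\dots,s_\ell)$ does not depend on $s_i$, we have $\big|\mathbb{E}_{n\in G}\mathbb{E}_{\mathbf{s}\in[S]^\ell}\big(f(n+\xi(\mathbf{s}))-\widetilde f(n+\xi(\mathbf{s}))\big)\prod_{i=1}^\ell u_i(n,\mathbf{s})\big|\leq\varepsilon$. -}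

module Defs where

open import Level using (0ℓ)
open import Data.Nat as ℕ using (ℕ; zero; suc; NonZero)
open import Data.Integer as ℤ using (ℤ; +_)
open import Data.Integer.DivMod using (_%ℕ_; n%ℕd<d)
open import Data.Fin as Fin using (Fin; toℕ; fromℕ<)
open import Data.Vec.Functional using (_∷_)
open import Data.Product using (_×_)
open import Relation.Nullary using (¬_)
open import Relation.Binary.PropositionalEquality using (_≡_)
open import Relation.Binary.Structures using (IsTotalOrder)
open import Algebra.Structures using (IsCommutativeRing)

-- Ordered fields (the paper uses ℝ; ℝ is an instance of this record).
-- Equality is propositional.  inv is total (its value at 0 is irrelevant).

record OrderedField : Set₁ where
  infixl 6 _+_
  infixl 7 _*_
  infix  8 -_
  infix  4 _≤_
  field
    Carrier : Set
    0# 1#   : Carrier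
    _+_ _*_ : Carrier → Carrier → Carrier
    -_      : Carrier → Carrier
    inv     : Carrier → Carrier
    _≤_     : Carrier → Carrier → Set
    isCommutativeRing : IsCommutativeRing _≡_ _+_ _*_ -_ 0# 1#
    0≢1     : ¬ (0# ≡ 1#)
    inv-r   : ∀ x → ¬ (x ≡ 0#) → x * inv x ≡ 1#
    isTotalOrder : IsTotalOrder _≡_ _≤_
    +-mono-≤ : ∀ {x y} z → x ≤ y → x + z ≤ y + z
    *-nonneg : ∀ {x y} → 0# ≤ x → 0# ≤ y → 0# ≤ x * y

  _<_ : Carrier → Carrier → Set
  x < y = (x ≤ y) × ¬ (x ≡ y)

  ∣_∣≤_ : Carrier → Carrier → Set
  ∣ x ∣≤ e = (x ≤ e) × (- x ≤ e)

  InUnit : Carrier → Set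
  InUnit x = ∣ x ∣≤ 1#

  fromℕ : ℕ → Carrier
  fromℕ zero    = 0#
  fromℕ (suc n) = 1# + fromℕ n

  sumFin : (n : ℕ) → (Fin n → Carrier) → Carrier
  sumFin zero    g = 0#
  sumFin (suc n) g = g Fin.zero + sumFin n (λ i → g (Fin.suc i))

  sumTuples : (ℓ S : ℕ) → ((Fin ℓ → Fin S) → Carrier) → Carrier
  sumTuples zero    S g = g (λ ())
  sumTuples (suc ℓ) S g = sumFin S (λ x → sumTuples ℓ S (λ v → g (x ∷ v)))

sumℤ : (n : ℕ) → (Fin n → ℤ) → ℤ
sumℤ zero    g = + 0
sumℤ (suc n) g = g Fin.zero ℤ.+ sumℤ n (λ i → g (Fin.suc i))

-- An element s of Fin S represents the integer toℕ s + 1 ∈ [S] = {1,…,S}.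
[S]→ℕ : {S : ℕ} → Fin S → ℕ
[S]→ℕ s = suc (toℕ s)

linForm : {ℓ S : ℕ} → (Fin ℓ → ℤ) → (Fin ℓ → Fin S) → ℤ
linForm {ℓ} a s = sumℤ ℓ (λ i → a i ℤ.* + [S]→ℕ (s i))

-- G = ℤ/Nℤ, represented as Fin N

G : ℕ → Set
G N = Fin N

ιℤ : (N : ℕ) .{{_ : NonZero N}} → ℤ → G N
ιℤ N z = fromℕ< (n%ℕd<d z N)

_+G_ : {N : ℕ} .{{_ : NonZero N}} → G N → ℤ → G N
_+G_ {N} n z = ιℤ N (+ toℕ n ℤ.+ z)

module _ (F : OrderedField) where
  open OrderedField F

  IndepOf : {N ℓ : ℕ} → Fin ℓ → (G N → (Fin ℓ → G N) → Carrier) → Set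
  IndepOf {N} {ℓ} i u =
    ∀ (n : G N) (s t : Fin ℓ → G N) → (∀ j → ¬ (j ≡ i) → s j ≡ t j) → u n s ≡ u n t

  discrepancyAvg : (N : ℕ) .{{_ : NonZero N}} (ℓ S : ℕ) (a : Fin ℓ → ℤ)
                   (f f̃ : G N → Carrier)
                   (u : Fin ℓ → G N → (Fin ℓ → G N) → Carrier) → Carrier
  discrepancyAvg N ℓ S a f f̃ u =
    inv (fromℕ N) * sumFin N (λ n →
      inv (fromℕ (S ℕ.^ ℓ)) * sumTuples ℓ S (λ s →
        let x  = n +G linForm a s
            sG = λ j → ιℤ N (+ [S]→ℕ (s j))
        in (f x + - f̃ x) * prodFin ℓ (λ i → u i n sG)))
    where
      prodFin : (m : ℕ) → (Fin m → Carrier) → Carrier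
      prodFin zero    g = 1#
      prodFin (suc m) g = g Fin.zero * prodFin m (λ i → g (Fin.suc i))

  IsDiscrepancyPair : (N : ℕ) .{{_ : NonZero N}} (ℓ : ℕ) (a : Fin ℓ → ℤ)
                      (ε : Carrier) (S : ℕ) (f f̃ : G N → Carrier) → Set
  IsDiscrepancyPair N ℓ a ε S f f̃ =
    ∀ (u : Fin ℓ → G N → (Fin ℓ → G N) → Carrier) →
      (∀ i n s → InUnit (u i n s)) →
      (∀ i → IndepOf i (u i)) →
      ∣ discrepancyAvg N ℓ S a f f̃ u ∣≤ ε

-- Write qᵢ = aᵢ / a′ᵢ and Q = m |qᵢ|. Cutting [QS] into blocks of |qᵢ| consecutive integers, each
-- s′ ∈ [QS] is uniquely qᵢ t + dᵢ(j) with t ∈ [S] and j ∈ [Q] (which row of blocks, and which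
-- position inside a block). Then a′ᵢ s′ᵢ = aᵢ tᵢ + a′ᵢ dᵢ(jᵢ), so ξ′(s′) = ξ(t) + C(j). For fixed j,
-- translating n by C(j) turns the part of the ξ′-average over these s′ into a ξ-average of width S
-- with weights u′ᵢ(n, t) = uᵢ(n − C(j), qᵢ t + dᵢ(jᵢ)), which are still [−1, 1]-valued and independent
-- of tᵢ. So the ξ′-discrepancy of width QS is an average over j ∈ [Q]^ℓ of ξ-discrepancies of width S.

module Submission where

open import Level using (0ℓ)
open import Data.Nat as ℕ using (ℕ; zero; suc; NonZero)
import Data.Nat.Properties as ℕₚ
open import Data.Nat.Tactic.RingSolver as ℕ-Solver using ()
open import Data.Integer as ℤ using (ℤ; -[1+_]; +[1+_])
import Data.Integer.Properties as ℤₚ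
open import Data.Integer.DivMod using (_%ℕ_; _/ℕ_; n%ℕd<d; a≡a%ℕn+[a/ℕn]*n)
open import Data.Integer.Divisibility using (_∣_)
open import Data.Integer.Tactic.RingSolver as ℤ-Solver using ()
open import Data.Nat.DivMod using (m<n⇒m%n≡m)
open import Data.Nat.Divisibility using (divides)
open import Data.Nat.Primality using (Prime; prime⇒nonZero)
open import Data.Fin as Fin using (Fin; toℕ; _↑ˡ_; _↑ʳ_; combine; remQuot; cast; opposite)
import Data.Fin.Properties as Finₚ
open import Data.Fin.Permutation using (permutation)
open import Data.Vec.Functional using (_∷_)
open import Function using (id)
open import Data.Product using (Σ; _×_; _,_; proj₁; proj₂)
open import Data.Sum using (inj₁; inj₂)
open import Data.Empty using (⊥-elim)
open import Relation.Nullary using (¬_)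
open import Relation.Binary.PropositionalEquality
open import Relation.Binary.Structures using (IsTotalOrder)
open import Algebra.Bundles using (CommutativeRing)
open import Algebra.Structures using (IsCommutativeRing)
open import Defs

import Algebra.Properties.CommutativeSemigroup ℤₚ.+-commutativeSemigroup as ℤ+

module Residues (N : ℕ) .{{_ : NonZero N}} where

  open import Data.Integer using (+_; _+_; _*_; -_)

  infix 4 _≡_[modN]

  record _≡_[modN] (z w : ℤ) : Set where
    constructor multiple
    field
      quotient   : ℤ
      difference : w ≡ z + quotient * + N

  open _≡_[modN] using (difference)

  ≡[modN]-sym : ∀ {z w} → z ≡ w [modN] → w ≡ z [modN]
  ≡[modN]-sym {z} (multiple k w≡z+kN) =
    multiple (- k) (subst (λ w → z ≡ w + - k * + N) (sym w≡z+kN) (lemma z k (+ N)))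
    where lemma : ∀ z k n → z ≡ (z + k * n) + (- k) * n
          lemma = ℤ-Solver.solve-∀

  ≡[modN]-trans : ∀ {x y z} → x ≡ y [modN] → y ≡ z [modN] → x ≡ z [modN]
  ≡[modN]-trans {x} (multiple k refl) (multiple k′ refl) = multiple (k + k′) (lemma x k k′ (+ N))
    where lemma : ∀ x k k′ n → (x + k * n) + k′ * n ≡ x + (k + k′) * n
          lemma = ℤ-Solver.solve-∀

  ≡[modN]-+ʳ : ∀ {z w} c → z ≡ w [modN] → z + c ≡ w + c [modN]
  ≡[modN]-+ʳ {z} c (multiple k refl) = multiple k (lemma z k (+ N) c)
    where lemma : ∀ z k n c → (z + k * n) + c ≡ (z + c) + k * n
          lemma = ℤ-Solver.solve-∀

  ≡[modN]-*ˡ : ∀ {z w} b → z ≡ w [modN] → b * z ≡ b * w [modN]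
  ≡[modN]-*ˡ {z} b (multiple k refl) = multiple (b * k) (lemma z k (+ N) b)
    where lemma : ∀ z k n b → b * (z + k * n) ≡ b * z + (b * k) * n
          lemma = ℤ-Solver.solve-∀

  %ℕ-≡[modN] : ∀ z → + (z %ℕ N) ≡ z [modN]
  %ℕ-≡[modN] z = multiple (z /ℕ N) (a≡a%ℕn+[a/ℕn]*n z N)

  no-positive-multiple : ∀ {r r′} m → r′ ℕ.< N → ¬ (+ r′ ≡ + r + +[1+ m ] * + N)
  no-positive-multiple {r} {r′} m r′<N eq = ℕₚ.<⇒≱ r′<N (begin
    N                      ≤⟨ ℕₚ.m≤m+n N (m ℕ.* N) ⟩
    suc m ℕ.* N            ≤⟨ ℕₚ.m≤n+m (suc m ℕ.* N) r ⟩
    r ℕ.+ suc m ℕ.* N      ≡⟨ ℤₚ.+-injective (trans (ℤₚ.pos-+ r (suc m ℕ.* N))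
                                (trans (cong (_+_ (+ r)) (ℤₚ.pos-* (suc m) N)) (sym eq))) ⟩
    r′                     ∎)
    where open ℕₚ.≤-Reasoning

  residue-unique : ∀ {r r′} → r ℕ.< N → r′ ℕ.< N → + r ≡ + r′ [modN] → r ≡ r′
  residue-unique {r} r<N r′<N (multiple (+ zero) eq) = sym (ℤₚ.+-injective (trans eq (ℤₚ.+-identityʳ (+ r))))
  residue-unique r<N r′<N (multiple +[1+ m ] eq) = ⊥-elim (no-positive-multiple m r′<N eq)
  residue-unique r<N r′<N r≡r′@(multiple -[1+ m ] _) =
    ⊥-elim (no-positive-multiple m r<N (difference (≡[modN]-sym r≡r′)))

  %ℕ-cong : ∀ {z w} → z ≡ w [modN] → z %ℕ N ≡ w %ℕ N
  %ℕ-cong {z} {w} z≡w = residue-unique (n%ℕd<d z N) (n%ℕd<d w N)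
    (≡[modN]-trans (%ℕ-≡[modN] z) (≡[modN]-trans z≡w (≡[modN]-sym (%ℕ-≡[modN] w))))

  toℕ-ιℤ : ∀ z → toℕ (ιℤ N z) ≡ z %ℕ N
  toℕ-ιℤ z = Finₚ.toℕ-fromℕ< (n%ℕd<d z N)

  ιℤ-cong : ∀ {z w} → z ≡ w [modN] → ιℤ N z ≡ ιℤ N w
  ιℤ-cong {z} {w} z≡w = Finₚ.toℕ-injective (trans (toℕ-ιℤ z) (trans (%ℕ-cong z≡w) (sym (toℕ-ιℤ w))))

  ιℤ-≡[modN] : ∀ z → + toℕ (ιℤ N z) ≡ z [modN]
  ιℤ-≡[modN] z = subst (λ r → + r ≡ z [modN]) (sym (toℕ-ιℤ z)) (%ℕ-≡[modN] z)

  ιℤ-affine : ∀ b c z → ιℤ N (b * + toℕ (ιℤ N z) + c) ≡ ιℤ N (b * z + c)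
  ιℤ-affine b c z = ιℤ-cong (≡[modN]-+ʳ c (≡[modN]-*ˡ b (ιℤ-≡[modN] z)))

  +G-assoc : ∀ (n : G N) x y → (n +G x) +G y ≡ n +G (x + y)
  +G-assoc n x y = trans (ιℤ-cong (≡[modN]-+ʳ y (ιℤ-≡[modN] (+ toℕ n + x))))
                         (cong (ιℤ N) (ℤₚ.+-assoc (+ toℕ n) x y))

  +G-identityʳ : ∀ (n : G N) → n +G (+ 0) ≡ n
  +G-identityʳ n = Finₚ.toℕ-injective (begin
    toℕ (n +G (+ 0))      ≡⟨ toℕ-ιℤ (+ toℕ n + + 0) ⟩
    (+ toℕ n + + 0) %ℕ N  ≡⟨ cong (_%ℕ N) (ℤₚ.+-identityʳ (+ toℕ n)) ⟩
    toℕ n ℕ.% N           ≡⟨ m<n⇒m%n≡m (Finₚ.toℕ<n n) ⟩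
    toℕ n                 ∎)
    where open ≡-Reasoning

  +G-inverseʳ : ∀ (n : G N) c → (n +G c) +G (- c) ≡ n
  +G-inverseʳ n c = trans (+G-assoc n c (- c)) (trans (cong (n +G_) (ℤₚ.+-inverseʳ c)) (+G-identityʳ n))

  +G-inverseˡ : ∀ (n : G N) c → (n +G (- c)) +G c ≡ n
  +G-inverseˡ n c = subst (λ c′ → (n +G (- c)) +G c′ ≡ n) (ℤₚ.neg-involutive c) (+G-inverseʳ n (- c))

module IntegerLemmas where

  open import Data.Integer using (+_; _+_; _*_; -_; _-_)
  open ≡-Reasoning

  sumℤ-cong : ∀ n {g h : Fin n → ℤ} → (∀ i → g i ≡ h i) → sumℤ n g ≡ sumℤ n h
  sumℤ-cong zero    g≗h = refl
  sumℤ-cong (suc n) g≗h = cong₂ _+_ (g≗h Fin.zero) (sumℤ-cong n (λ i → g≗h (Fin.suc i)))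

  sumℤ-+ : ∀ n (g h : Fin n → ℤ) → sumℤ n (λ i → g i + h i) ≡ sumℤ n g + sumℤ n h
  sumℤ-+ zero    g h = refl
  sumℤ-+ (suc n) g h = trans (cong (_+_ (g Fin.zero + h Fin.zero)) (sumℤ-+ n (λ i → g (Fin.suc i)) (λ i → h (Fin.suc i))))
                             (ℤ+.interchange (g Fin.zero) (h Fin.zero) _ _)

  pos-affine⁺ : ∀ {x} p y z → x ℕ.+ p ≡ p ℕ.* y ℕ.+ z → + x ≡ + p * + y + (+ z - + p)
  pos-affine⁺ {x} p y z x+p≡py+z = begin
    + x                       ≡⟨ lemma (+ x) (+ p) ⟩
    + x + + p - + p           ≡⟨ cong (_- + p) (sym (ℤₚ.pos-+ x p)) ⟩
    + (x ℕ.+ p) - + p         ≡⟨ cong (λ w → + w - + p) x+p≡py+z ⟩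
    + (p ℕ.* y ℕ.+ z) - + p   ≡⟨ cong (_- + p) (trans (ℤₚ.pos-+ (p ℕ.* y) z) (cong (_+ + z) (ℤₚ.pos-* p y))) ⟩
    + p * + y + + z - + p     ≡⟨ lemma′ (+ p) (+ y) (+ z) ⟩
    + p * + y + (+ z - + p)   ∎
    where
      lemma : ∀ x p → x ≡ x + p - p
      lemma = ℤ-Solver.solve-∀
      lemma′ : ∀ p y z → p * y + z - p ≡ p * y + (z - p)
      lemma′ = ℤ-Solver.solve-∀

  pos-affine⁻ : ∀ {x} p y z → x ℕ.+ p ℕ.* y ≡ z → + x ≡ - + p * + y + + z
  pos-affine⁻ {x} p y z x+py≡z = begin
    + x                          ≡⟨ lemma (+ x) (+ p) (+ y) ⟩
    - + p * + y + (+ x + + p * + y) ≡⟨ cong (_+_ (- + p * + y)) (begin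
        + x + + p * + y          ≡⟨ cong (_+_ (+ x)) (sym (ℤₚ.pos-* p y)) ⟩
        + x + + (p ℕ.* y)        ≡⟨ sym (ℤₚ.pos-+ x (p ℕ.* y)) ⟩
        + (x ℕ.+ p ℕ.* y)        ≡⟨ cong +_ x+py≡z ⟩
        + z                      ∎) ⟩
    - + p * + y + + z            ∎
    where
      lemma : ∀ x p y → x ≡ - p * y + (x + p * y)
      lemma = ℤ-Solver.solve-∀

open IntegerLemmas

^-distribʳ-* : ∀ m n ℓ → (m ℕ.* n) ℕ.^ ℓ ≡ m ℕ.^ ℓ ℕ.* n ℕ.^ ℓ
^-distribʳ-* m n zero    = refl
^-distribʳ-* m n (suc ℓ) = trans (cong (m ℕ.* n ℕ.*_) (^-distribʳ-* m n ℓ))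
                                 (ℕₚ.[m*n]*[o*p]≡[m*o]*[n*p] m n (m ℕ.^ ℓ) (n ℕ.^ ℓ))

module OrderedFieldProperties (F : OrderedField) where

  open OrderedField F
  open IsCommutativeRing isCommutativeRing
    using ( +-assoc; +-comm; +-identityˡ; +-identityʳ; -‿inverseˡ; -‿inverseʳ
          ; *-assoc; *-comm; *-identityˡ; *-identityʳ; distribˡ; distribʳ; zeroˡ; zeroʳ)
  open IsTotalOrder isTotalOrder using (total; antisym) renaming (refl to ≤-refl; trans to ≤-trans)

  commutativeRing : CommutativeRing 0ℓ 0ℓ
  commutativeRing = record { isCommutativeRing = isCommutativeRing }

  open CommutativeRing commutativeRing using (ring; +-commutativeMonoid; *-commutativeSemigroup)
  open import Algebra.Properties.Ring ring using (-‿distribˡ-*; -‿distribʳ-*; -‿+-comm; -‿involutive; -0#≈0#)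
  open import Algebra.Properties.CommutativeSemigroup *-commutativeSemigroup using (x∙yz≈y∙xz)
  import Algebra.Properties.CommutativeMonoid.Sum +-commutativeMonoid as Sum

  +-mono₂-≤ : ∀ {x y x′ y′} → x ≤ y → x′ ≤ y′ → x + x′ ≤ y + y′
  +-mono₂-≤ {x} {y} {x′} {y′} x≤y x′≤y′ =
    ≤-trans (+-mono-≤ x′ x≤y) (subst₂ _≤_ (+-comm x′ y) (+-comm y′ y) (+-mono-≤ y x′≤y′))

  x≤y⇒0≤y-x : ∀ {x y} → x ≤ y → 0# ≤ y + - x
  x≤y⇒0≤y-x {x} {y} x≤y = subst (_≤ y + - x) (-‿inverseʳ x) (+-mono-≤ (- x) x≤y)

  x≤0⇒0≤-x : ∀ {x} → x ≤ 0# → 0# ≤ - x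
  x≤0⇒0≤-x {x} x≤0 = subst (0# ≤_) (+-identityˡ (- x)) (x≤y⇒0≤y-x x≤0)

  0≤1 : 0# ≤ 1#
  0≤1 with total 0# 1#
  ... | inj₁ positive = positive
  ... | inj₂ 1≤0 = subst (0# ≤_) -1*-1≡1 (*-nonneg (x≤0⇒0≤-x 1≤0) (x≤0⇒0≤-x 1≤0))
    where
      -1*-1≡1 : - 1# * - 1# ≡ 1#
      -1*-1≡1 = begin
        - 1# * - 1#   ≡⟨ sym (-‿distribˡ-* 1# (- 1#)) ⟩
        - (1# * - 1#) ≡⟨ cong -_ (*-identityˡ (- 1#)) ⟩
        - - 1#        ≡⟨ -‿involutive 1# ⟩
        1#            ∎
        where open ≡-Reasoning

  0≤fromℕ : ∀ n → 0# ≤ fromℕ n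
  0≤fromℕ zero    = ≤-refl
  0≤fromℕ (suc n) = subst (_≤ fromℕ (suc n)) (+-identityˡ 0#) (+-mono₂-≤ 0≤1 (0≤fromℕ n))

  fromℕ-suc≢0 : ∀ n → ¬ (fromℕ (suc n) ≡ 0#)
  fromℕ-suc≢0 n 1+n≡0 =
    0≢1 (antisym 0≤1 (subst₂ _≤_ (+-identityʳ 1#) 1+n≡0 (+-mono₂-≤ ≤-refl (0≤fromℕ n))))

  *-monoˡ-≤ : ∀ {c x y} → 0# ≤ c → x ≤ y → c * x ≤ c * y
  *-monoˡ-≤ {c} {x} {y} 0≤c x≤y =
    subst₂ _≤_ (+-identityˡ (c * x)) c[y-x]+cx≡cy (+-mono-≤ (c * x) (*-nonneg 0≤c (x≤y⇒0≤y-x x≤y)))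
    where
      c[y-x]+cx≡cy : c * (y + - x) + c * x ≡ c * y
      c[y-x]+cx≡cy = begin
        c * (y + - x) + c * x ≡⟨ sym (distribˡ c _ x) ⟩
        c * (y + - x + x)     ≡⟨ cong (c *_) (+-assoc y (- x) x) ⟩
        c * (y + (- x + x))   ≡⟨ cong (λ z → c * (y + z)) (-‿inverseˡ x) ⟩
        c * (y + 0#)          ≡⟨ cong (c *_) (+-identityʳ y) ⟩
        c * y                 ∎
        where open ≡-Reasoning

  inv-cancelˡ : ∀ {x} → ¬ (x ≡ 0#) → ∀ y → inv x * (x * y) ≡ y
  inv-cancelˡ {x} x≢0 y = begin
    inv x * (x * y) ≡⟨ sym (*-assoc (inv x) x y) ⟩
    inv x * x * y   ≡⟨ cong (_* y) (trans (*-comm (inv x) x) (inv-r x x≢0)) ⟩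
    1# * y          ≡⟨ *-identityˡ y ⟩
    y               ∎
    where open ≡-Reasoning

  inv-unique : ∀ {x y} → ¬ (x ≡ 0#) → x * y ≡ 1# → inv x ≡ y
  inv-unique {x} {y} x≢0 xy≡1 = begin
    inv x            ≡⟨ sym (*-identityʳ (inv x)) ⟩
    inv x * 1#       ≡⟨ cong (inv x *_) (sym xy≡1) ⟩
    inv x * (x * y)  ≡⟨ inv-cancelˡ x≢0 y ⟩
    y                ∎
    where open ≡-Reasoning

  *-≢0 : ∀ {x y} → ¬ (x ≡ 0#) → ¬ (y ≡ 0#) → ¬ (x * y ≡ 0#)
  *-≢0 {x} {y} x≢0 y≢0 xy≡0 = y≢0 (begin
    y                ≡⟨ sym (inv-cancelˡ x≢0 y) ⟩
    inv x * (x * y)  ≡⟨ cong (inv x *_) xy≡0 ⟩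
    inv x * 0#       ≡⟨ zeroʳ (inv x) ⟩
    0#               ∎)
    where open ≡-Reasoning

  inv-* : ∀ {x y} → ¬ (x ≡ 0#) → ¬ (y ≡ 0#) → inv (x * y) ≡ inv x * inv y
  inv-* {x} {y} x≢0 y≢0 = inv-unique (*-≢0 x≢0 y≢0) (begin
    x * y * (inv x * inv y)    ≡⟨ *-assoc x y _ ⟩
    x * (y * (inv x * inv y))  ≡⟨ cong (x *_) (x∙yz≈y∙xz y (inv x) (inv y)) ⟩
    x * (inv x * (y * inv y))  ≡⟨ sym (*-assoc x (inv x) _) ⟩
    x * inv x * (y * inv y)    ≡⟨ cong₂ _*_ (inv-r x x≢0) (inv-r y y≢0) ⟩
    1# * 1#                    ≡⟨ *-identityˡ 1# ⟩
    1#                         ∎)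
    where open ≡-Reasoning

  0≤inv : ∀ {x} → 0# ≤ x → ¬ (x ≡ 0#) → 0# ≤ inv x
  0≤inv {x} 0≤x x≢0 with total 0# (inv x)
  ... | inj₁ 0≤x⁻¹ = 0≤x⁻¹
  ... | inj₂ x⁻¹≤0 = ⊥-elim (0≢1 (antisym 0≤1 1≤0))
    where
      0≤-1 : 0# ≤ - 1#
      0≤-1 = subst (0# ≤_) (trans (sym (-‿distribʳ-* x (inv x))) (cong -_ (inv-r x x≢0)))
                   (*-nonneg 0≤x (x≤0⇒0≤-x x⁻¹≤0))
      1≤0 : 1# ≤ 0#
      1≤0 = subst₂ _≤_ (+-identityˡ 1#) (-‿inverseˡ 1#) (+-mono-≤ 1# 0≤-1)

  fromℕ-+ : ∀ m n → fromℕ (m ℕ.+ n) ≡ fromℕ m + fromℕ n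
  fromℕ-+ zero    n = sym (+-identityˡ (fromℕ n))
  fromℕ-+ (suc m) n = trans (cong (1# +_) (fromℕ-+ m n)) (sym (+-assoc 1# (fromℕ m) (fromℕ n)))

  fromℕ-* : ∀ m n → fromℕ (m ℕ.* n) ≡ fromℕ m * fromℕ n
  fromℕ-* zero    n = sym (zeroˡ (fromℕ n))
  fromℕ-* (suc m) n = begin
    fromℕ (n ℕ.+ m ℕ.* n)             ≡⟨ fromℕ-+ n (m ℕ.* n) ⟩
    fromℕ n + fromℕ (m ℕ.* n)         ≡⟨ cong₂ _+_ (sym (*-identityˡ (fromℕ n))) (fromℕ-* m n) ⟩
    1# * fromℕ n + fromℕ m * fromℕ n  ≡⟨ sym (distribʳ (fromℕ n) 1# (fromℕ m)) ⟩
    (1# + fromℕ m) * fromℕ n          ∎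
    where open ≡-Reasoning

  fromℕ-^-≢0 : ∀ {m} ℓ → 1 ℕ.≤ m → ¬ (fromℕ (m ℕ.^ ℓ) ≡ 0#)
  fromℕ-^-≢0 zero    _ = fromℕ-suc≢0 0
  fromℕ-^-≢0 {suc m} (suc ℓ) 1≤m eq =
    *-≢0 (fromℕ-suc≢0 m) (fromℕ-^-≢0 ℓ 1≤m) (trans (sym (fromℕ-* (suc m) (suc m ℕ.^ ℓ))) eq)

  sumFin≡sum : ∀ n (g : Fin n → Carrier) → sumFin n g ≡ Sum.sum g
  sumFin≡sum zero    g = refl
  sumFin≡sum (suc n) g = cong (g Fin.zero +_) (sumFin≡sum n (λ i → g (Fin.suc i)))

  sumFin-cong : ∀ n {g h : Fin n → Carrier} → (∀ i → g i ≡ h i) → sumFin n g ≡ sumFin n h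
  sumFin-cong zero    g≗h = refl
  sumFin-cong (suc n) g≗h = cong₂ _+_ (g≗h Fin.zero) (sumFin-cong n (λ i → g≗h (Fin.suc i)))

  *-distribˡ-sumFin : ∀ n c (g : Fin n → Carrier) → c * sumFin n g ≡ sumFin n (λ i → c * g i)
  *-distribˡ-sumFin zero    c g = zeroʳ c
  *-distribˡ-sumFin (suc n) c g = trans (distribˡ c _ _) (cong (c * g Fin.zero +_) (*-distribˡ-sumFin n c (λ i → g (Fin.suc i))))

  neg-distrib-sumFin : ∀ n (g : Fin n → Carrier) → - sumFin n g ≡ sumFin n (λ i → - g i)
  neg-distrib-sumFin zero    g = -0#≈0#
  neg-distrib-sumFin (suc n) g = trans (sym (-‿+-comm _ _)) (cong (- g Fin.zero +_) (neg-distrib-sumFin n (λ i → g (Fin.suc i))))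

  sumFin-const : ∀ n c → sumFin n (λ _ → c) ≡ fromℕ n * c
  sumFin-const zero    c = sym (zeroˡ c)
  sumFin-const (suc n) c = trans (cong₂ _+_ (sym (*-identityˡ c)) (sumFin-const n c)) (sym (distribʳ c 1# (fromℕ n)))

  sumFin-mono : ∀ n {g h : Fin n → Carrier} → (∀ i → g i ≤ h i) → sumFin n g ≤ sumFin n h
  sumFin-mono zero    g≤h = ≤-refl
  sumFin-mono (suc n) g≤h = +-mono₂-≤ (g≤h Fin.zero) (sumFin-mono n (λ i → g≤h (Fin.suc i)))

  sumFin-comm : ∀ m n (h : Fin m → Fin n → Carrier) →
                sumFin m (λ i → sumFin n (h i)) ≡ sumFin n (λ j → sumFin m (λ i → h i j))
  sumFin-comm m n h = begin
    sumFin m (λ i → sumFin n (h i))           ≡⟨ sumFin-cong m (λ i → sumFin≡sum n (h i)) ⟩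
    sumFin m (λ i → Sum.sum (h i))            ≡⟨ sumFin≡sum m _ ⟩
    Sum.sum (λ i → Sum.sum (h i))             ≡⟨ Sum.∑-comm h ⟩
    Sum.sum (λ j → Sum.sum (λ i → h i j))     ≡⟨ sym (sumFin≡sum n _) ⟩
    sumFin n (λ j → Sum.sum (λ i → h i j))    ≡⟨ sym (sumFin-cong n (λ j → sumFin≡sum m (λ i → h i j))) ⟩
    sumFin n (λ j → sumFin m (λ i → h i j))   ∎
    where open ≡-Reasoning

  sumFin-permute : ∀ n (σ τ : Fin n → Fin n) → (∀ i → σ (τ i) ≡ i) → (∀ i → τ (σ i) ≡ i) →
                   (h : Fin n → Carrier) → sumFin n (λ i → h (σ i)) ≡ sumFin n h
  sumFin-permute n σ τ στ≗id τσ≗id h = begin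
    sumFin n (λ i → h (σ i))  ≡⟨ sumFin≡sum n _ ⟩
    Sum.sum (λ i → h (σ i))   ≡⟨ sym (Sum.sum-permute h (permutation σ τ στ≗id τσ≗id)) ⟩
    Sum.sum h                 ≡⟨ sym (sumFin≡sum n h) ⟩
    sumFin n h                ∎
    where open ≡-Reasoning

  sumFin-++ : ∀ m n (h : Fin (m ℕ.+ n) → Carrier) →
              sumFin (m ℕ.+ n) h ≡ sumFin m (λ i → h (i ↑ˡ n)) + sumFin n (λ j → h (m ↑ʳ j))
  sumFin-++ zero    n h = sym (+-identityˡ _)
  sumFin-++ (suc m) n h = trans (cong (h Fin.zero +_) (sumFin-++ m n (λ i → h (Fin.suc i)))) (sym (+-assoc _ _ _))

  sumFin-combine : ∀ m n (h : Fin (m ℕ.* n) → Carrier) →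
                   sumFin (m ℕ.* n) h ≡ sumFin m (λ i → sumFin n (λ j → h (combine i j)))
  sumFin-combine zero    n h = refl
  sumFin-combine (suc m) n h = trans (sumFin-++ n (m ℕ.* n) h)
    (cong (sumFin n (λ j → h (j ↑ˡ (m ℕ.* n))) +_) (sumFin-combine m n (λ x → h (n ↑ʳ x))))

  sumFin-cast : ∀ {m n} (m≡n : m ≡ n) (h : Fin n → Carrier) → sumFin n h ≡ sumFin m (λ i → h (cast m≡n i))
  sumFin-cast {m} refl h = sumFin-cong m (λ i → cong h (sym (Finₚ.cast-is-id refl i)))

  sumTuples-cong : ∀ ℓ S {g h : (Fin ℓ → Fin S) → Carrier} → (∀ s → g s ≡ h s) → sumTuples ℓ S g ≡ sumTuples ℓ S h
  sumTuples-cong zero    S g≗h = g≗h _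
  sumTuples-cong (suc ℓ) S g≗h = sumFin-cong S (λ x → sumTuples-cong ℓ S (λ v → g≗h (x ∷ v)))

  *-distribˡ-sumTuples : ∀ ℓ S c (g : (Fin ℓ → Fin S) → Carrier) → c * sumTuples ℓ S g ≡ sumTuples ℓ S (λ s → c * g s)
  *-distribˡ-sumTuples zero    S c g = refl
  *-distribˡ-sumTuples (suc ℓ) S c g = trans (*-distribˡ-sumFin S c _) (sumFin-cong S (λ x → *-distribˡ-sumTuples ℓ S c (λ v → g (x ∷ v))))

  neg-distrib-sumTuples : ∀ ℓ S (g : (Fin ℓ → Fin S) → Carrier) → - sumTuples ℓ S g ≡ sumTuples ℓ S (λ s → - g s)
  neg-distrib-sumTuples zero    S g = refl
  neg-distrib-sumTuples (suc ℓ) S g = trans (neg-distrib-sumFin S _) (sumFin-cong S (λ x → neg-distrib-sumTuples ℓ S (λ v → g (x ∷ v))))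

  sumTuples-const : ∀ ℓ S c → sumTuples ℓ S (λ _ → c) ≡ fromℕ (S ℕ.^ ℓ) * c
  sumTuples-const zero    S c = sym (trans (cong (_* c) (+-identityʳ 1#)) (*-identityˡ c))
  sumTuples-const (suc ℓ) S c = begin
    sumFin S (λ _ → sumTuples ℓ S (λ _ → c))  ≡⟨ sumFin-cong S (λ _ → sumTuples-const ℓ S c) ⟩
    sumFin S (λ _ → fromℕ (S ℕ.^ ℓ) * c)      ≡⟨ sumFin-const S _ ⟩
    fromℕ S * (fromℕ (S ℕ.^ ℓ) * c)           ≡⟨ sym (*-assoc _ _ c) ⟩
    fromℕ S * fromℕ (S ℕ.^ ℓ) * c             ≡⟨ cong (_* c) (sym (fromℕ-* S (S ℕ.^ ℓ))) ⟩
    fromℕ (S ℕ.* S ℕ.^ ℓ) * c                 ∎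
    where open ≡-Reasoning

  sumTuples-mono : ∀ ℓ S {g h : (Fin ℓ → Fin S) → Carrier} → (∀ s → g s ≤ h s) → sumTuples ℓ S g ≤ sumTuples ℓ S h
  sumTuples-mono zero    S g≤h = g≤h _
  sumTuples-mono (suc ℓ) S g≤h = sumFin-mono S (λ x → sumTuples-mono ℓ S (λ v → g≤h (x ∷ v)))

  sumFin-sumTuples-comm : ∀ n ℓ S (h : Fin n → (Fin ℓ → Fin S) → Carrier) →
    sumFin n (λ x → sumTuples ℓ S (h x)) ≡ sumTuples ℓ S (λ s → sumFin n (λ x → h x s))
  sumFin-sumTuples-comm n zero    S h = refl
  sumFin-sumTuples-comm n (suc ℓ) S h = trans (sumFin-comm n S _)
    (sumFin-cong S (λ y → sumFin-sumTuples-comm n ℓ S (λ x v → h x (y ∷ v))))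

  avgFin : (n : ℕ) → (Fin n → Carrier) → Carrier
  avgFin n g = inv (fromℕ n) * sumFin n g

  avgTuples : (ℓ S : ℕ) → ((Fin ℓ → Fin S) → Carrier) → Carrier
  avgTuples ℓ S g = inv (fromℕ (S ℕ.^ ℓ)) * sumTuples ℓ S g

  avgFin-cong : ∀ n {g h : Fin n → Carrier} → (∀ i → g i ≡ h i) → avgFin n g ≡ avgFin n h
  avgFin-cong n g≗h = cong (inv (fromℕ n) *_) (sumFin-cong n g≗h)

  avgTuples-cong : ∀ ℓ S {g h : (Fin ℓ → Fin S) → Carrier} → (∀ s → g s ≡ h s) → avgTuples ℓ S g ≡ avgTuples ℓ S h
  avgTuples-cong ℓ S g≗h = cong (inv (fromℕ (S ℕ.^ ℓ)) *_) (sumTuples-cong ℓ S g≗h)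

  avgFin-avgTuples-comm : ∀ n ℓ S (h : Fin n → (Fin ℓ → Fin S) → Carrier) →
    avgFin n (λ x → avgTuples ℓ S (h x)) ≡ avgTuples ℓ S (λ s → avgFin n (λ x → h x s))
  avgFin-avgTuples-comm n ℓ S h = begin
    c * sumFin n (λ x → d * sumTuples ℓ S (h x))
      ≡⟨ cong (c *_) (sumFin-cong n (λ x → *-distribˡ-sumTuples ℓ S d (h x))) ⟩
    c * sumFin n (λ x → sumTuples ℓ S (λ s → d * h x s))
      ≡⟨ cong (c *_) (sumFin-sumTuples-comm n ℓ S _) ⟩
    c * sumTuples ℓ S (λ s → sumFin n (λ x → d * h x s))
      ≡⟨ cong (c *_) (sumTuples-cong ℓ S (λ s → sym (*-distribˡ-sumFin n d _))) ⟩
    c * sumTuples ℓ S (λ s → d * sumFin n (λ x → h x s))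
      ≡⟨ cong (c *_) (sym (*-distribˡ-sumTuples ℓ S d _)) ⟩
    c * (d * sumTuples ℓ S (λ s → sumFin n (λ x → h x s)))
      ≡⟨ x∙yz≈y∙xz c d _ ⟩
    d * (c * sumTuples ℓ S (λ s → sumFin n (λ x → h x s)))
      ≡⟨ cong (d *_) (*-distribˡ-sumTuples ℓ S c _) ⟩
    d * sumTuples ℓ S (λ s → c * sumFin n (λ x → h x s)) ∎
    where
      open ≡-Reasoning
      c = inv (fromℕ n)
      d = inv (fromℕ (S ℕ.^ ℓ))

  avgFin-permute : ∀ n (σ τ : Fin n → Fin n) → (∀ i → σ (τ i) ≡ i) → (∀ i → τ (σ i) ≡ i) →
                   (h : Fin n → Carrier) → avgFin n (λ i → h (σ i)) ≡ avgFin n h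
  avgFin-permute n σ τ στ≗id τσ≗id h = cong (inv (fromℕ n) *_) (sumFin-permute n σ τ στ≗id τσ≗id h)

  neg-distrib-avgTuples : ∀ ℓ S (g : (Fin ℓ → Fin S) → Carrier) → - avgTuples ℓ S g ≡ avgTuples ℓ S (λ s → - g s)
  neg-distrib-avgTuples ℓ S g = trans (-‿distribʳ-* _ _) (cong (inv (fromℕ (S ℕ.^ ℓ)) *_) (neg-distrib-sumTuples ℓ S g))

  avgTuples-≤ : ∀ ℓ {S} → 1 ℕ.≤ S → ∀ {g : (Fin ℓ → Fin S) → Carrier} {ε} → (∀ s → g s ≤ ε) → avgTuples ℓ S g ≤ ε
  avgTuples-≤ ℓ {S} 1≤S {g} {ε} g≤ε =
    subst (avgTuples ℓ S g ≤_) (trans (cong (c *_) (sumTuples-const ℓ S ε)) (inv-cancelˡ Sˡ≢0 ε))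
      (*-monoˡ-≤ (0≤inv (0≤fromℕ (S ℕ.^ ℓ)) Sˡ≢0) (sumTuples-mono ℓ S g≤ε))
    where
      c = inv (fromℕ (S ℕ.^ ℓ))
      Sˡ≢0 = fromℕ-^-≢0 ℓ 1≤S

  avgTuples-bounded : ∀ ℓ {S} → 1 ℕ.≤ S → ∀ {g : (Fin ℓ → Fin S) → Carrier} {ε} →
                      (∀ s → ∣ g s ∣≤ ε) → ∣ avgTuples ℓ S g ∣≤ ε
  avgTuples-bounded ℓ {S} 1≤S {g} g≤ε =
    avgTuples-≤ ℓ 1≤S (λ s → proj₁ (g≤ε s)) ,
    subst (_≤ _) (sym (neg-distrib-avgTuples ℓ S g)) (avgTuples-≤ ℓ 1≤S (λ s → proj₂ (g≤ε s)))

module Decompositions (F : OrderedField) where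

  open OrderedField F
  open OrderedFieldProperties F
  open import Data.Integer using (+_)
  open ≡-Reasoning

  record Decomposition (Q S : ℕ) (q : ℤ) : Set where
    field
      embed        : Fin Q → Fin S → Fin (Q ℕ.* S)
      offset       : Fin Q → ℤ
      embed-affine : ∀ j t → + [S]→ℕ (embed j t) ≡ q ℤ.* + [S]→ℕ t ℤ.+ offset j
      sumFin-embed : ∀ h → sumFin (Q ℕ.* S) h ≡ sumFin Q (λ j → sumFin S (λ t → h (embed j t)))

  -- j ∈ Fin Q is split as (k, r) ∈ Fin m × Fin p, and (j, t) goes to p (S k + σ t) + r.
  module Blocks {Q S p m} (Q≡m*p : Q ≡ m ℕ.* p) (σ : Fin S → Fin S) where

    m*S*p≡Q*S : m ℕ.* S ℕ.* p ≡ Q ℕ.* S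
    m*S*p≡Q*S = trans (lemma m S p) (cong (ℕ._* S) (sym Q≡m*p))
      where
        lemma : ∀ m S p → m ℕ.* S ℕ.* p ≡ m ℕ.* p ℕ.* S
        lemma = ℕ-Solver.solve-∀

    block : Fin Q → Fin m × Fin p
    block j = remQuot p (cast Q≡m*p j)

    embed : Fin Q → Fin S → Fin (Q ℕ.* S)
    embed j t = cast m*S*p≡Q*S (combine (combine (proj₁ (block j)) (σ t)) (proj₂ (block j)))

    toℕ-embed : ∀ j t → toℕ (embed j t) ≡
                p ℕ.* (S ℕ.* toℕ (proj₁ (block j)) ℕ.+ toℕ (σ t)) ℕ.+ toℕ (proj₂ (block j))
    toℕ-embed j t = begin
      toℕ (embed j t)                                   ≡⟨ Finₚ.toℕ-cast m*S*p≡Q*S _ ⟩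
      toℕ (combine (combine k (σ t)) r)                 ≡⟨ Finₚ.toℕ-combine (combine k (σ t)) r ⟩
      p ℕ.* toℕ (combine k (σ t)) ℕ.+ toℕ r             ≡⟨ cong (λ x → p ℕ.* x ℕ.+ toℕ r) (Finₚ.toℕ-combine k (σ t)) ⟩
      p ℕ.* (S ℕ.* toℕ k ℕ.+ toℕ (σ t)) ℕ.+ toℕ r       ∎
      where
        k = proj₁ (block j)
        r = proj₂ (block j)

    block-combine : ∀ k r → block (cast (sym Q≡m*p) (combine k r)) ≡ (k , r)
    block-combine k r = trans (cong (remQuot p) (Finₚ.cast-involutive Q≡m*p (sym Q≡m*p) (combine k r)))
                              (Finₚ.remQuot-combine k r)

    sumFin-embed : (∀ h → sumFin S (λ t → h (σ t)) ≡ sumFin S h) →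
                   ∀ h → sumFin (Q ℕ.* S) h ≡ sumFin Q (λ j → sumFin S (λ t → h (embed j t)))
    sumFin-embed σ-invariant h = begin
      sumFin (Q ℕ.* S) h
        ≡⟨ sumFin-cast m*S*p≡Q*S h ⟩
      sumFin (m ℕ.* S ℕ.* p) (λ x → h (cast m*S*p≡Q*S x))
        ≡⟨ sumFin-combine (m ℕ.* S) p _ ⟩
      sumFin (m ℕ.* S) (λ y → sumFin p (λ r → h′ y r))
        ≡⟨ sumFin-combine m S _ ⟩
      sumFin m (λ k → sumFin S (λ t → sumFin p (λ r → h′ (combine k t) r)))
        ≡⟨ sumFin-cong m (λ k → sym (σ-invariant (λ t → sumFin p (λ r → h′ (combine k t) r)))) ⟩
      sumFin m (λ k → sumFin S (λ t → sumFin p (λ r → h′ (combine k (σ t)) r)))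
        ≡⟨ sumFin-cong m (λ k → sumFin-comm S p _) ⟩
      sumFin m (λ k → sumFin p (λ r → sumFin S (λ t → h′ (combine k (σ t)) r)))
        ≡⟨ sumFin-cong m (λ k → sumFin-cong p (λ r → sumFin-cong S (λ t →
             cong (λ kr → h′ (combine (proj₁ kr) (σ t)) (proj₂ kr)) (sym (block-combine k r))))) ⟩
      sumFin m (λ k → sumFin p (λ r → sumFin S (λ t → h (embed (cast (sym Q≡m*p) (combine k r)) t))))
        ≡⟨ sym (sumFin-combine m p _) ⟩
      sumFin (m ℕ.* p) (λ j → sumFin S (λ t → h (embed (cast (sym Q≡m*p) j) t)))
        ≡⟨ sym (sumFin-cast (sym Q≡m*p) _) ⟩
      sumFin Q (λ j → sumFin S (λ t → h (embed j t)))   ∎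
      where
        h′ : Fin (m ℕ.* S) → Fin p → Carrier
        h′ y r = h (cast m*S*p≡Q*S (combine y r))

  decomposition : ∀ {Q} S {q} → ¬ (q ≡ + 0) → q ∣ + Q → Decomposition Q S q
  decomposition S {+ zero} q≢0 _ = ⊥-elim (q≢0 refl)
  decomposition S {+[1+ p′ ]} _ (divides m Q≡m*p) = record
    { embed        = embed
    ; offset       = λ j → + suc (p ℕ.* (S ℕ.* k j) ℕ.+ r j) ℤ.- + p
    ; embed-affine = λ j t → trans (cong (λ x → + suc x) (toℕ-embed j t))
                                   (pos-affine⁺ p (suc (toℕ t)) _ (lemma p S (k j) (toℕ t) (r j)))
    ; sumFin-embed = sumFin-embed (λ h → refl)
    }
    where
      p = suc p′
      open Blocks {p = p} {m = m} Q≡m*p id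
      k = λ j → toℕ (proj₁ (block j))
      r = λ j → toℕ (proj₂ (block j))
      lemma : ∀ p S k t r → suc (p ℕ.* (S ℕ.* k ℕ.+ t) ℕ.+ r) ℕ.+ p ≡ p ℕ.* suc t ℕ.+ suc (p ℕ.* (S ℕ.* k) ℕ.+ r)
      lemma = ℕ-Solver.solve-∀
  decomposition S { -[1+ p′ ]} _ (divides m Q≡m*p) = record
    { embed        = embed
    ; offset       = λ j → + (p ℕ.* (S ℕ.* k j) ℕ.+ p ℕ.* S ℕ.+ suc (r j))
    ; embed-affine = λ j t → trans (cong (λ x → + suc x) (toℕ-embed j t))
                                   (pos-affine⁻ p (suc (toℕ t)) _ (reflected (k j) (r j) _ (toℕ t) S (o+t+1≡S t)))
    ; sumFin-embed = sumFin-embed (sumFin-permute S opposite opposite Finₚ.opposite-involutive Finₚ.opposite-involutive)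
    }
    where
      p = suc p′
      -- q < 0, so t runs through each block backwards.
      open Blocks {p = p} {m = m} Q≡m*p opposite
      k = λ j → toℕ (proj₁ (block j))
      r = λ j → toℕ (proj₂ (block j))
      lemma : ∀ p k o t r → suc (p ℕ.* ((o ℕ.+ suc t) ℕ.* k ℕ.+ o) ℕ.+ r) ℕ.+ p ℕ.* suc t ≡
                            p ℕ.* ((o ℕ.+ suc t) ℕ.* k) ℕ.+ p ℕ.* (o ℕ.+ suc t) ℕ.+ suc r
      lemma = ℕ-Solver.solve-∀
      reflected : ∀ k r o t S′ → o ℕ.+ suc t ≡ S′ →
                  suc (p ℕ.* (S′ ℕ.* k ℕ.+ o) ℕ.+ r) ℕ.+ p ℕ.* suc t ≡ p ℕ.* (S′ ℕ.* k) ℕ.+ p ℕ.* S′ ℕ.+ suc r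
      reflected k r o t _ refl = lemma p k o t r
      o+t+1≡S : ∀ (t : Fin S) → toℕ (opposite t) ℕ.+ suc (toℕ t) ≡ S
      o+t+1≡S t = trans (cong (ℕ._+ suc (toℕ t)) (Finₚ.opposite-prop t)) (ℕₚ.m∸n+n≡m (Finₚ.toℕ<n t))

  open Decomposition

  embedTuple : ∀ {ℓ Q S} {q : Fin ℓ → ℤ} → (∀ i → Decomposition Q S (q i)) →
               (Fin ℓ → Fin Q) → (Fin ℓ → Fin S) → Fin ℓ → Fin (Q ℕ.* S)
  embedTuple D j t i = embed (D i) (j i) (t i)

  sumTuples-decompose : ∀ ℓ {Q S} {q : Fin ℓ → ℤ} (D : ∀ i → Decomposition Q S (q i))
    (h : (Fin ℓ → Fin (Q ℕ.* S)) → Carrier) → (∀ {s s′} → s ≗ s′ → h s ≡ h s′) →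
    sumTuples ℓ (Q ℕ.* S) h ≡ sumTuples ℓ Q (λ j → sumTuples ℓ S (λ t → h (embedTuple D j t)))
  sumTuples-decompose zero    D h h-resp = h-resp (λ ())
  sumTuples-decompose (suc ℓ) {Q} {S} D h h-resp = begin
    sumFin (Q ℕ.* S) (λ x → sumTuples ℓ (Q ℕ.* S) (λ s → h (x ∷ s)))
      ≡⟨ sumFin-cong (Q ℕ.* S) (λ x → sumTuples-decompose ℓ (λ i → D (Fin.suc i)) (λ s → h (x ∷ s))
           (λ s≗s′ → h-resp (λ { Fin.zero → refl ; (Fin.suc i) → s≗s′ i }))) ⟩
    sumFin (Q ℕ.* S) (λ x → sumTuples ℓ Q (λ j → sumTuples ℓ S (λ t → h (x ∷ embedTuple D′ j t))))
      ≡⟨ sumFin-embed (D Fin.zero) _ ⟩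
    sumFin Q (λ j₀ → sumFin S (λ t₀ → sumTuples ℓ Q (λ j → sumTuples ℓ S (λ t →
      h (embed (D Fin.zero) j₀ t₀ ∷ embedTuple D′ j t)))))
      ≡⟨ sumFin-cong Q (λ j₀ → sumFin-sumTuples-comm S ℓ Q _) ⟩
    sumFin Q (λ j₀ → sumTuples ℓ Q (λ j → sumFin S (λ t₀ → sumTuples ℓ S (λ t →
      h (embed (D Fin.zero) j₀ t₀ ∷ embedTuple D′ j t)))))
      ≡⟨ sumFin-cong Q (λ j₀ → sumTuples-cong ℓ Q (λ j → sumFin-cong S (λ t₀ → sumTuples-cong ℓ S (λ t →
           h-resp (λ { Fin.zero → refl ; (Fin.suc i) → refl }))))) ⟩
    sumFin Q (λ j₀ → sumTuples ℓ Q (λ j → sumFin S (λ t₀ → sumTuples ℓ S (λ t →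
      h (embedTuple D (j₀ ∷ j) (t₀ ∷ t)))))) ∎
    where
      D′ = λ i → D (Fin.suc i)

  avgTuples-decompose : ∀ ℓ {Q S} → 1 ℕ.≤ Q → 1 ℕ.≤ S → {q : Fin ℓ → ℤ} (D : ∀ i → Decomposition Q S (q i))
    (h : (Fin ℓ → Fin (Q ℕ.* S)) → Carrier) → (∀ {s s′} → s ≗ s′ → h s ≡ h s′) →
    avgTuples ℓ (Q ℕ.* S) h ≡ avgTuples ℓ Q (λ j → avgTuples ℓ S (λ t → h (embedTuple D j t)))
  avgTuples-decompose ℓ {Q} {S} 1≤Q 1≤S D h h-resp = begin
    inv (fromℕ ((Q ℕ.* S) ℕ.^ ℓ)) * sumTuples ℓ (Q ℕ.* S) h
      ≡⟨ cong₂ _*_ inv-split (sumTuples-decompose ℓ D h h-resp) ⟩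
    iQ * iS * sumTuples ℓ Q (λ j → sumTuples ℓ S (λ t → h (embedTuple D j t)))
      ≡⟨ *-assoc iQ iS _ ⟩
    iQ * (iS * sumTuples ℓ Q (λ j → sumTuples ℓ S (λ t → h (embedTuple D j t))))
      ≡⟨ cong (iQ *_) (*-distribˡ-sumTuples ℓ Q iS _) ⟩
    avgTuples ℓ Q (λ j → avgTuples ℓ S (λ t → h (embedTuple D j t))) ∎
    where
      open IsCommutativeRing isCommutativeRing using (*-assoc)
      iQ = inv (fromℕ (Q ℕ.^ ℓ))
      iS = inv (fromℕ (S ℕ.^ ℓ))
      inv-split : inv (fromℕ ((Q ℕ.* S) ℕ.^ ℓ)) ≡ iQ * iS
      inv-split = trans (cong (λ n → inv (fromℕ n)) (^-distribʳ-* Q S ℓ))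
        (trans (cong inv (fromℕ-* (Q ℕ.^ ℓ) (S ℕ.^ ℓ))) (inv-* (fromℕ-^-≢0 ℓ 1≤Q) (fromℕ-^-≢0 ℓ 1≤S)))

module Rescaling (F : OrderedField) (N : ℕ) .{{_ : NonZero N}} where

  open OrderedField F
  open OrderedFieldProperties F
  open Decompositions F
  open Decomposition
  open Residues N
  open import Data.Integer using (+_)
  open ≡-Reasoning

  -- The product ∏ᵢ uᵢ in `discrepancyAvg` is local to its definition; unification recovers it.
  product : Σ ((m : ℕ) → (Fin m → Carrier) → Carrier) λ ∏ → ∀ m g →
    discrepancyAvg F 1 m 1 (λ _ → + 0) (λ _ → 1#) (λ _ → 1#) (λ i _ _ → g i) ≡
      inv (fromℕ 1) * sumFin 1 (λ _ → inv (fromℕ (1 ℕ.^ m)) * sumTuples m 1 (λ _ → (1# + - 1#) * ∏ m g))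
  product = _ , λ _ _ → refl

  ∏ : (m : ℕ) → (Fin m → Carrier) → Carrier
  ∏ = proj₁ product

  ∏-cong : ∀ m {g h : Fin m → Carrier} → (∀ i → g i ≡ h i) → ∏ m g ≡ ∏ m h
  ∏-cong zero    g≗h = refl
  ∏-cong (suc m) g≗h = cong₂ _*_ (g≗h Fin.zero) (∏-cong m (λ i → g≗h (Fin.suc i)))

  Weights : ℕ → Set
  Weights ℓ = Fin ℓ → G N → (Fin ℓ → G N) → Carrier

  discrepancyTerm : ∀ {ℓ S} → (Fin ℓ → ℤ) → (f f̃ : G N → Carrier) → Weights ℓ → G N → (Fin ℓ → Fin S) → Carrier
  discrepancyTerm {ℓ} a f f̃ u n s =
    (f (n +G linForm a s) + - f̃ (n +G linForm a s)) * ∏ ℓ (λ i → u i n (λ j → ιℤ N (+ [S]→ℕ (s j))))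

  IndepOf-cong : ∀ {ℓ} {i : Fin ℓ} {v : G N → (Fin ℓ → G N) → Carrier} →
                 IndepOf F i v → ∀ n {s t} → s ≗ t → v n s ≡ v n t
  IndepOf-cong v-indep n s≗t = v-indep n _ _ (λ j _ → s≗t j)

  discrepancyTerm-cong : ∀ {ℓ S} a f f̃ {u : Weights ℓ} → (∀ i → IndepOf F i (u i)) →
    ∀ n {s s′ : Fin ℓ → Fin S} → s ≗ s′ → discrepancyTerm a f f̃ u n s ≡ discrepancyTerm a f f̃ u n s′
  discrepancyTerm-cong {ℓ} a f f̃ u-indep n s≗s′ =
    cong₂ _*_ (cong (λ x → f x + - f̃ x) (cong (n +G_) (sumℤ-cong ℓ (λ i → cong (λ x → a i ℤ.* + [S]→ℕ x) (s≗s′ i)))))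
              (∏-cong ℓ (λ i → IndepOf-cong (u-indep i) n (λ j → cong (λ x → ιℤ N (+ [S]→ℕ x)) (s≗s′ j))))

  shift-invariant : ∀ c (g : G N → Carrier) → avgFin N (λ n → g (n +G c)) ≡ avgFin N g
  shift-invariant c = avgFin-permute N (_+G c) (_+G (ℤ.- c)) (λ n → +G-inverseˡ n c) (λ n → +G-inverseʳ n c)

  module _ {ℓ Q S} {a a′ q : Fin ℓ → ℤ} (a≡qa′ : ∀ i → a i ≡ q i ℤ.* a′ i)
           (D : ∀ i → Decomposition Q S (q i)) where

    shift : (Fin ℓ → Fin Q) → ℤ
    shift j = sumℤ ℓ (λ i → a′ i ℤ.* offset (D i) (j i))

    linForm-embedTuple : ∀ j t → linForm a′ (embedTuple D j t) ≡ shift j ℤ.+ linForm a t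
    linForm-embedTuple j t = trans (sumℤ-cong ℓ coordinate) (sumℤ-+ ℓ _ _)
      where
        lemma : ∀ a′ q x d → a′ ℤ.* (q ℤ.* x ℤ.+ d) ≡ a′ ℤ.* d ℤ.+ q ℤ.* a′ ℤ.* x
        lemma = ℤ-Solver.solve-∀
        coordinate : ∀ i → a′ i ℤ.* + [S]→ℕ (embedTuple D j t i) ≡
                           a′ i ℤ.* offset (D i) (j i) ℤ.+ a i ℤ.* + [S]→ℕ (t i)
        coordinate i = begin
          a′ i ℤ.* + [S]→ℕ (embed (D i) (j i) (t i))
            ≡⟨ cong (a′ i ℤ.*_) (embed-affine (D i) (j i) (t i)) ⟩
          a′ i ℤ.* (q i ℤ.* + [S]→ℕ (t i) ℤ.+ offset (D i) (j i))
            ≡⟨ lemma (a′ i) (q i) _ _ ⟩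
          a′ i ℤ.* offset (D i) (j i) ℤ.+ q i ℤ.* a′ i ℤ.* + [S]→ℕ (t i)
            ≡⟨ cong (λ b → a′ i ℤ.* offset (D i) (j i) ℤ.+ b ℤ.* + [S]→ℕ (t i)) (sym (a≡qa′ i)) ⟩
          a′ i ℤ.* offset (D i) (j i) ℤ.+ a i ℤ.* + [S]→ℕ (t i) ∎

    rescaled : (Fin ℓ → Fin Q) → Weights ℓ → Weights ℓ
    rescaled j u i n s = u i (n +G (ℤ.- shift j)) (λ k → ιℤ N (q k ℤ.* + toℕ (s k) ℤ.+ offset (D k) (j k)))

    rescaled-InUnit : ∀ j {u} → (∀ i n s → InUnit (u i n s)) → ∀ i n s → InUnit (rescaled j u i n s)
    rescaled-InUnit j u-unit i n s = u-unit i _ _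

    rescaled-IndepOf : ∀ j {u} → (∀ i → IndepOf F i (u i)) → ∀ i → IndepOf F i (rescaled j u i)
    rescaled-IndepOf j u-indep i n s t s≈t = u-indep i _ _ _ (λ k k≢i →
      cong (λ x → ιℤ N (q k ℤ.* + toℕ x ℤ.+ offset (D k) (j k))) (s≈t k k≢i))

    discrepancyTerm-embedTuple : ∀ f f̃ {u} → (∀ i → IndepOf F i (u i)) → ∀ n j t →
      discrepancyTerm a′ f f̃ u n (embedTuple D j t) ≡ discrepancyTerm a f f̃ (rescaled j u) (n +G shift j) t
    discrepancyTerm-embedTuple f f̃ {u} u-indep n j t =
      cong₂ _*_ (cong (λ x → f x + - f̃ x) point) (∏-cong ℓ (λ i → begin
        u i n sE                                       ≡⟨ cong (λ m → u i m sE) (sym (+G-inverseʳ n (shift j))) ⟩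
        u i ((n +G shift j) +G (ℤ.- shift j)) sE       ≡⟨ IndepOf-cong (u-indep i) _ embedded ⟩
        rescaled j u i (n +G shift j) sT               ∎))
      where
        sE = λ k → ιℤ N (+ [S]→ℕ (embedTuple D j t k))
        sT = λ k → ιℤ N (+ [S]→ℕ (t k))
        point : n +G linForm a′ (embedTuple D j t) ≡ (n +G shift j) +G linForm a t
        point = trans (cong (n +G_) (linForm-embedTuple j t)) (sym (+G-assoc n (shift j) (linForm a t)))
        embedded : ∀ k → sE k ≡ ιℤ N (q k ℤ.* + toℕ (sT k) ℤ.+ offset (D k) (j k))
        embedded k = trans (cong (ιℤ N) (embed-affine (D k) (j k) (t k)))
                           (sym (ιℤ-affine (q k) (offset (D k) (j k)) (+ [S]→ℕ (t k))))

    discrepancyAvg-rescale : 1 ℕ.≤ Q → 1 ℕ.≤ S → ∀ f f̃ {u} → (∀ i → IndepOf F i (u i)) →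
      discrepancyAvg F N ℓ (Q ℕ.* S) a′ f f̃ u ≡
      avgTuples ℓ Q (λ j → discrepancyAvg F N ℓ S a f f̃ (rescaled j u))
    discrepancyAvg-rescale 1≤Q 1≤S f f̃ {u} u-indep = begin
      discrepancyAvg F N ℓ (Q ℕ.* S) a′ f f̃ u
        ≡⟨⟩
      avgFin N (λ n → avgTuples ℓ (Q ℕ.* S) (discrepancyTerm a′ f f̃ u n))
        ≡⟨ avgFin-cong N (λ n → avgTuples-decompose ℓ 1≤Q 1≤S D _ (discrepancyTerm-cong a′ f f̃ u-indep n)) ⟩
      avgFin N (λ n → avgTuples ℓ Q (λ j → avgTuples ℓ S (λ t → discrepancyTerm a′ f f̃ u n (embedTuple D j t))))
        ≡⟨ avgFin-cong N (λ n → avgTuples-cong ℓ Q (λ j → avgTuples-cong ℓ S (λ t →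
             discrepancyTerm-embedTuple f f̃ u-indep n j t))) ⟩
      avgFin N (λ n → avgTuples ℓ Q (λ j → avgTuples ℓ S (discrepancyTerm a f f̃ (rescaled j u) (n +G shift j))))
        ≡⟨ avgFin-avgTuples-comm N ℓ Q _ ⟩
      avgTuples ℓ Q (λ j → avgFin N (λ n → avgTuples ℓ S (discrepancyTerm a f f̃ (rescaled j u) (n +G shift j))))
        ≡⟨ avgTuples-cong ℓ Q (λ j → shift-invariant (shift j) _) ⟩
      avgTuples ℓ Q (λ j → avgFin N (λ n → avgTuples ℓ S (discrepancyTerm a f f̃ (rescaled j u) n)))
        ≡⟨⟩
      avgTuples ℓ Q (λ j → discrepancyAvg F N ℓ S a f f̃ (rescaled j u)) ∎

open import Data.Nat using (_≤_; _*_)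
open import Data.Integer using (+_) renaming (_*_ to _*ℤ_)

lemma8p3 : (F : OrderedField) (N : ℕ) (pN : Prime N) (ℓ : ℕ)
           (a a′ : Fin ℓ → ℤ) →
           (∀ i → ¬ (a i ≡ + 0)) → (∀ i → ¬ (a′ i ≡ + 0)) →
           (Q : ℕ) → 1 ≤ Q →
           (∀ i → Σ ℤ (λ q → (a i ≡ q *ℤ a′ i) × (q ∣ + Q))) →
           (S : ℕ) → 2 ≤ S →
           (ε : OrderedField.Carrier F) → OrderedField._<_ F (OrderedField.0# F) ε →
           (f f̃ : G N → OrderedField.Carrier F) →
           IsDiscrepancyPair F N {{prime⇒nonZero pN}} ℓ a ε S f f̃ →
           IsDiscrepancyPair F N {{prime⇒nonZero pN}} ℓ a′ ε (Q * S) f f̃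
lemma8p3 F N pN ℓ a a′ a≢0 _ Q 1≤Q q-divides S 2≤S ε _ f f̃ a-pair u u-unit u-indep =
  subst (λ x → ∣ x ∣≤ ε) (sym (discrepancyAvg-rescale a≡qa′ D 1≤Q 1≤S f f̃ u-indep))
    (avgTuples-bounded ℓ 1≤Q (λ j →
      a-pair (rescaled a≡qa′ D j u) (rescaled-InUnit a≡qa′ D j u-unit) (rescaled-IndepOf a≡qa′ D j u-indep)))
  where
    open OrderedField F
    open OrderedFieldProperties F
    open Decompositions F
    open Rescaling F N {{prime⇒nonZero pN}}
    q = λ i → proj₁ (q-divides i)
    a≡qa′ = λ i → proj₁ (proj₂ (q-divides i))
    1≤S = ℕₚ.<⇒≤ 2≤S
    D : ∀ i → Decomposition Q S (q i)
    D i = decomposition S (λ q≡0 → a≢0 i (trans (a≡qa′ i) (cong (_*ℤ a′ i) q≡0))) (proj₂ (proj₂ (q-divides i)))
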